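{- Fix positive integers $k<n$. Given a cylindric partition $\mu$ on $\mathcal{C}_{k,n}$ and a nonnegative integer $t$, there is a bijection between marble games of length $t$ with initial arrangement $\operatorname{Arr}(\mu)$ and semistandard cylindric tableaux with entries in $\{1,2,\dots,t\}$ and inner shape $\mu$ (and arbitrary outer shape).
   Context: The cylinder $\mathcal{C}_{k,n}$ is $\mathbb{Z}^2/(-k,n-k)\mathbb{Z}$; boxes are its elements (classes of points $(x,y)$, $x$ the row, $y$ the column). A cylindric partition is a weakly decreasing bi-infinite integer sequence $(\lambda_i)$ with $\lambda_i=\lambda_{i+k}+n-k$. A point $(x,y)$ is in $\lambda$ iff $y\le\lambda_x$. $\mu\subseteq\lambda$ means $\mu_i\le\lambda_i$ for all $i$. A semistandard cylindric tableau with inner shape $\mu$ and outer shape $\lambda\supseteq\mu$ is a map from the boxes in $\lambda$ but not in $\mu$ to a totally ordered set, weakly increasing along plane rows and strictly increasing down plane columns (for points in $\lambda$ but not $\mu$); the shapes are part of the data. Marble game: there are $k$ people $p_0,\dots,p_{k-1}$ in a circle, indices taken mod $k$, with $p_i$ clockwise from $p_{i-1}$. The marble arrangement $\operatorname{Arr}(\alpha)$ of a cylindric partition $\alpha$ gives $p_i$ exactly $\alpha_{i-1}-\alpha_i$ marbles (total $n-k$). A turn is a tuple $(a_0,\dots,a_{k-1})$ of nonnegative integers in which, simultaneously, each $p_i$ passes $a_i$ marbles to $p_{i+1}$, where $a_i$ is at most the number of marbles $p_i$ currently has. A marble game of length $t$ is an initial arrangement of the $n-k$ marbles among the $k$ people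 together with a sequence of $t$ successive turns. -}

module Defs where

open import Data.Nat as ℕ using (ℕ; NonZero)
open import Data.Nat.DivMod using (_mod_)
open import Data.Fin using (Fin; toℕ)
open import Data.Integer as ℤ using (ℤ; +_; _-_; _≤_; _<_; ∣_∣) renaming (_+_ to _+ℤ_)
open import Data.Vec using (Vec; []; _∷_)
open import Data.Vec.Relation.Binary.Pointwise.Inductive as PW using (Pointwise)
open import Data.Unit using (⊤)
open import Data.Product using (_×_; _,_)
open import Relation.Binary.PropositionalEquality as Eq using (_≡_)
open import Relation.Binary.Bundles using (Setoid)
open import Relation.Binary.Structures using (IsEquivalence)

record CylPart (k n : ℕ) : Set where
  field
    part   : ℤ → ℤ
    decr   : ∀ i j → i ≤ j → part j ≤ part i
    period : ∀ i → part i ≡ part (i +ℤ + k) +ℤ (+ n - + k)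
open CylPart public

InSkew : ∀ {k n} → CylPart k n → CylPart k n → ℤ → ℤ → Set
InSkew μ la x y = part μ x < y × y ≤ part la x

-- A map from the boxes of the cylinder
-- (classes of points modulo (-k, n-k)) in λ∖μ is encoded as a map on
-- points of λ∖μ that is invariant under the translation by (-k, n-k).

record Tableau (k n t : ℕ) (μ : CylPart k n) : Set where
  field
    outer   : CylPart k n
    inner⊆  : ∀ i → part μ i ≤ part outer i
    entry   : ℤ → ℤ → ℕ
    cyl     : ∀ x y → InSkew μ outer x y →
              entry x y ≡ entry (x - + k) (y +ℤ (+ n - + k))
    range   : ∀ x y → InSkew μ outer x y → 1 ℕ.≤ entry x y × entry x y ℕ.≤ t
    rowWeak : ∀ x y y' → y ≤ y' → InSkew μ outer x y → InSkew μ outer x y' →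
              entry x y ℕ.≤ entry x y'
    colStr  : ∀ x x' y → x < x' → InSkew μ outer x y → InSkew μ outer x' y →
              entry x y ℕ.< entry x' y
open Tableau public

_≈T_ : ∀ {k n t μ} → Tableau k n t μ → Tableau k n t μ → Set
_≈T_ {μ = μ} T U =
  (∀ i → part (outer T) i ≡ part (outer U) i) ×
  (∀ x y → InSkew μ (outer T) x y → entry T x y ≡ entry U x y)

TableauSetoid : ∀ k n t (μ : CylPart k n) → Setoid _ _
TableauSetoid k n t μ = record
  { Carrier = Tableau k n t μ
  ; _≈_ = _≈T_
  ; isEquivalence = record
    { refl  = (λ i → Eq.refl) , (λ x y _ → Eq.refl)
    ; sym   = λ {T} {U} (p , q) → (λ i → Eq.sym (p i)) ,
                (λ x y s → Eq.sym (q x y (skew {T} {U} p s)))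
    ; trans = λ {T} {U} {V} (p , q) (p' , q') → (λ i → Eq.trans (p i) (p' i)) ,
                (λ x y s → Eq.trans (q x y s) (q' x y (skew' {T} {U} p s)))
    }
  }
  where
  skew : ∀ {T U : Tableau k n t μ} → (∀ i → part (outer T) i ≡ part (outer U) i) →
         ∀ {x y} → InSkew μ (outer U) x y → InSkew μ (outer T) x y
  skew {T} {U} p {x} {y} (a , b) = a , Eq.subst (y ≤_) (Eq.sym (p x)) b
  skew' : ∀ {T U : Tableau k n t μ} → (∀ i → part (outer T) i ≡ part (outer U) i) →
          ∀ {x y} → InSkew μ (outer T) x y → InSkew μ (outer U) x y
  skew' {T} {U} p {x} {y} (a , b) = a , Eq.subst (y ≤_) (p x) b

-- Marble games.  People p_0,…,p_{k-1} are indexed by Fin k; p_{i+1} is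
-- clockwise from p_i (indices mod k).

Arrangement : ℕ → Set
Arrangement k = Fin k → ℕ

Turn : ℕ → Set
Turn k = Fin k → ℕ

prevIdx : ∀ k .{{_ : NonZero k}} → Fin k → Fin k
prevIdx k i = (toℕ i ℕ.+ (k ℕ.∸ 1)) mod k

Arr : ∀ {k n} → CylPart k n → Arrangement k
Arr α i = ∣ part α (+ toℕ i - + 1) - part α (+ toℕ i) ∣

applyTurn : ∀ {k} .{{_ : NonZero k}} → Arrangement k → Turn k → Arrangement k
applyTurn {k} m a i = (m i ℕ.∸ a i) ℕ.+ a (prevIdx k i)

Legal : ∀ {k} .{{_ : NonZero k}} {t} → Arrangement k → Vec (Turn k) t → Set
Legal m []       = ⊤
Legal m (a ∷ as) = (∀ i → a i ℕ.≤ m i) × Legal (applyTurn m a) as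

record MarbleGame (k : ℕ) .{{_ : NonZero k}} (t : ℕ) (m : Arrangement k) : Set where
  field
    turns : Vec (Turn k) t
    legal : Legal m turns
open MarbleGame public

_≈G_ : ∀ {k} .{{_ : NonZero k}} {t m} → MarbleGame k t m → MarbleGame k t m → Set
g ≈G h = Pointwise (λ a b → ∀ i → a i ≡ b i) (turns g) (turns h)

GameSetoid : ∀ k .{{_ : NonZero k}} t (m : Arrangement k) → Setoid _ _
GameSetoid k t m = record
  { Carrier = MarbleGame k t m
  ; _≈_ = _≈G_
  ; isEquivalence = record
    { refl  = PW.refl (λ i → Eq.refl)
    ; sym   = PW.sym (λ p i → Eq.sym (p i))
    ; trans = PW.trans (λ p q i → Eq.trans (p i) (q i))
    }
  }

module Submission where

-- A game of length t is read as the chain of cylindric partitions μ = α⁰ ⊆ α¹ ⊆ ⋯ ⊆ αᵗ in which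
-- row x of αˢ exceeds μₓ by the number of marbles p_(x mod k) has passed during the first s turns.
-- Since p_i holds α_(i-1) - α_i marbles, a turn is legal exactly when α^(s+1)_(x+1) ≤ αˢ_x for all x,
-- i.e. when α^(s+1)/αˢ is a horizontal strip; filling these strips with s + 1 is exactly a semistandard
-- cylindric tableau of shape αᵗ/μ with entries in {1,…,t}. Conversely, the entries ≤ s of a tableau
-- form the shape αˢ, and the turns are the increments of its rows.

open import Data.Fin using (Fin; toℕ; fromℕ<)
open import Data.Fin.Properties using (toℕ-fromℕ<; toℕ-injective; toℕ<n)
open import Data.Integer as ℤ using (ℤ; +_; -[1+_]; _+_; _-_; _*_; -_; ∣_∣; +≤+; +<+; 0ℤ; 1ℤ)
import Data.Integer.Properties as ℤ
open import Data.Integer.DivMod using (_/ℕ_; n%ℕd<d; a≡a%ℕn+[a/ℕn]*n)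
open import Data.Integer.Tactic.RingSolver using (solve-∀)
open import Data.Nat as ℕ using (ℕ; zero; suc; NonZero)
import Data.Nat.Properties as ℕ
open import Data.Nat.DivMod using (_mod_; m%n<n; m≡m%n+[m/n]*n)
open import Data.Product using (∃; _×_; _,_; proj₁; proj₂)
open import Data.Sum using (inj₁; inj₂)
open import Data.Unit using (tt)
open import Data.Vec using (Vec; []; _∷_)
open import Data.Vec.Relation.Binary.Pointwise.Inductive using (Pointwise; []; _∷_)
open import Function using (_∘_)
open import Function.Bundles using (Bijection)
open import Relation.Binary.Bundles using (Setoid)
open import Relation.Binary.Definitions using (tri<; tri≈; tri>)
open import Relation.Binary.PropositionalEquality
open import Relation.Nullary using (yes; no; ¬_; contradiction)
open import Relation.Unary using (Decidable)

open import Defs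

module Counting where
  open import Data.Nat using (_≤_; _<_; z≤n; s≤s; s≤s⁻¹)
  open import Data.Nat.Properties

  count : {P : ℕ → Set} → Decidable P → ℕ → ℕ
  count P? zero = 0
  count P? (suc m) with P? m
  ... | yes _ = suc (count P? m)
  ... | no  _ = count P? m

  DownClosed : (ℕ → Set) → ℕ → Set
  DownClosed P m = ∀ {i j} → i ≤ j → j < m → P j → P i

  module _ {P : ℕ → Set} (P? : Decidable P) where

    count-≤ : ∀ m → count P? m ≤ m
    count-≤ zero = z≤n
    count-≤ (suc m) with P? m
    ... | yes _ = s≤s (count-≤ m)
    ... | no  _ = m≤n⇒m≤1+n (count-≤ m)

    count-≤-suc : ∀ m → count P? m ≤ count P? (suc m)
    count-≤-suc m with P? m
    ... | yes _ = n≤1+n _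
    ... | no  _ = ≤-refl

    count-monoʳ : ∀ {m m'} → m ≤ m' → count P? m ≤ count P? m'
    count-monoʳ {m' = zero} z≤n = z≤n
    count-monoʳ {m' = suc m'} m≤1+m' with m≤n⇒m<n∨m≡n m≤1+m'
    ... | inj₁ m<1+m' = ≤-trans (count-monoʳ (s≤s⁻¹ m<1+m')) (count-≤-suc m')
    ... | inj₂ refl   = ≤-refl

    count-all : ∀ m → (∀ {j} → j < m → P j) → count P? m ≡ m
    count-all zero    _   = refl
    count-all (suc m) all with P? m
    ... | yes _ = cong suc (count-all m (all ∘ m<n⇒m<1+n))
    ... | no ¬p = contradiction (all ≤-refl) ¬p

    count-none-from : ∀ c m → c ≤ m → (∀ {j} → c ≤ j → j < m → ¬ P j) →
                      count P? m ≡ count P? c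
    count-none-from c zero    z≤n  _    = refl
    count-none-from c (suc m) c≤1+m none with m≤n⇒m<n∨m≡n c≤1+m
    ... | inj₂ refl = refl
    ... | inj₁ c<1+m with P? m
    ...   | yes p = contradiction p (none (s≤s⁻¹ c<1+m) ≤-refl)
    ...   | no  _ = count-none-from c m (s≤s⁻¹ c<1+m) (λ c≤j j<m → none c≤j (m<n⇒m<1+n j<m))

    count-exact : ∀ {m c} → c ≤ m → (∀ {j} → j < m → P j → j < c) →
                  (∀ {j} → j < c → P j) → count P? m ≡ c
    count-exact {m} {c} c≤m below prefix =
      trans (count-none-from c m c≤m (λ c≤j j<m p → <⇒≱ (below j<m p) c≤j)) (count-all c prefix)

    module _ {m} (down : DownClosed P m) where

      holds⇒<count : ∀ {j} → j < m → P j → j < count P? m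
      holds⇒<count {j} j<m p =
        subst (_≤ count P? m) (count-all (suc j) (λ i<1+j → down (s≤s⁻¹ i<1+j) j<m p))
              (count-monoʳ j<m)

      <count⇒holds : ∀ {j} → j < count P? m → P j
      <count⇒holds {j} j<count with P? j
      ... | yes p = p
      ... | no ¬p = contradiction (subst (_≤ j) (sym count≡) (count-≤ j)) (<⇒≱ j<count)
        where
        count≡ : count P? m ≡ count P? j
        count≡ = count-none-from j m (<⇒≤ (<-≤-trans j<count (count-≤ m)))
                   (λ j≤i i<m pᵢ → ¬p (down j≤i i<m pᵢ))

  count-mono : ∀ {P Q : ℕ → Set} (P? : Decidable P) (Q? : Decidable Q) m →
               (∀ {j} → j < m → P j → Q j) → count P? m ≤ count Q? m
  count-mono P? Q? zero    _   = z≤n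
  count-mono P? Q? (suc m) P⇒Q with P? m | Q? m
  ... | yes _ | yes _ = s≤s (count-mono P? Q? m (P⇒Q ∘ m<n⇒m<1+n))
  ... | yes p | no ¬q = contradiction (P⇒Q ≤-refl p) ¬q
  ... | no  _ | yes _ = m≤n⇒m≤1+n (count-mono P? Q? m (P⇒Q ∘ m<n⇒m<1+n))
  ... | no  _ | no  _ = count-mono P? Q? m (P⇒Q ∘ m<n⇒m<1+n)

  count-cong : ∀ {P Q : ℕ → Set} (P? : Decidable P) (Q? : Decidable Q) m →
               (∀ {j} → j < m → P j → Q j) → (∀ {j} → j < m → Q j → P j) →
               count P? m ≡ count Q? m
  count-cong P? Q? m P⇒Q Q⇒P = ≤-antisym (count-mono P? Q? m P⇒Q) (count-mono Q? P? m Q⇒P)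

module IntegerArithmetic where
  open import Data.Integer using (_≤_; _<_)

  +-cancelˡ-≤ : ∀ i {j l} → i + j ≤ i + l → j ≤ l
  +-cancelˡ-≤ i {j} {l} = subst₂ _≤_ (e i j) (e i l) ∘ ℤ.+-monoʳ-≤ (- i)
    where
    e : ∀ a b → - a + (a + b) ≡ b
    e = solve-∀

  +-cancelˡ-< : ∀ i {j l} → i + j < i + l → j < l
  +-cancelˡ-< i {j} {l} = subst₂ _<_ (e i j) (e i l) ∘ ℤ.+-monoʳ-< (- i)
    where
    e : ∀ a b → - a + (a + b) ≡ b
    e = solve-∀

  +-cancelʳ-< : ∀ i {j l} → j + i < l + i → j < l
  +-cancelʳ-< i {j} {l} = +-cancelˡ-< i ∘ subst₂ _<_ (ℤ.+-comm j i) (ℤ.+-comm l i)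

  i<i+1+n : ∀ i n → i < i + + suc n
  i<i+1+n i n = subst (_< i + + suc n) (ℤ.+-identityʳ i) (ℤ.+-monoʳ-< i (+<+ ℕ.z<s))

  i<j⇒i+1≤j : ∀ {i j} → i < j → i + 1ℤ ≤ j
  i<j⇒i+1≤j {i} = subst (_≤ _) (ℤ.+-comm 1ℤ i) ∘ ℤ.i<j⇒suc[i]≤j

  j≡i+[j-i] : ∀ i j → j ≡ i + (j - i)
  j≡i+[j-i] = solve-∀

  i-j≡[i+l]-[j+l] : ∀ i j l → i - j ≡ (i + l) - (j + l)
  i-j≡[i+l]-[j+l] = solve-∀

  <⇒≡+suc : ∀ {i j} → i < j → ∃ λ d → j ≡ i + + suc d
  <⇒≡+suc {i} {j} i<j with j - i in j-i≡ | ℤ.i≤j⇒0≤j-i (ℤ.<⇒≤ i<j)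
  ... | + suc d | _ = d , trans (j≡i+[j-i] i j) (cong (_+_ i) j-i≡)
  ... | + zero  | _ = contradiction
    (trans (j≡i+[j-i] i j) (trans (cong (_+_ i) j-i≡) (ℤ.+-identityʳ i))) (ℤ.<⇒≢ i<j ∘ sym)

  i+m<i+1+n⇒m≤n : ∀ i {m n} → i + + m < i + + suc n → m ℕ.≤ n
  i+m<i+1+n⇒m≤n i = ℕ.s≤s⁻¹ ∘ ℤ.drop‿+<+ ∘ +-cancelˡ-< i

  m≤n⇒i+m<i+1+n : ∀ i {m n} → m ℕ.≤ n → i + + m < i + + suc n
  m≤n⇒i+m<i+1+n i = ℤ.+-monoʳ-< i ∘ +<+ ∘ ℕ.s≤s

  antitone-by-steps : (f : ℤ → ℤ) → (∀ x → f (x + 1ℤ) ≤ f x) →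
                      ∀ {i j} → i ≤ j → f j ≤ f i
  antitone-by-steps f step {i} {j} i≤j = subst (λ z → f z ≤ f i) i+d≡j (descend ∣ j - i ∣)
    where
    descend : ∀ d → f (i + + d) ≤ f i
    descend zero    = ℤ.≤-reflexive (cong f (ℤ.+-identityʳ i))
    descend (suc d) = ℤ.≤-trans (ℤ.≤-reflexive (cong f (e i (+ d))))
                                (ℤ.≤-trans (step (i + + d)) (descend d))
      where
      e : ∀ i d → i + (1ℤ + d) ≡ i + d + 1ℤ
      e = solve-∀
    i+d≡j : i + + ∣ j - i ∣ ≡ j
    i+d≡j = trans (cong (_+_ i) (ℤ.0≤i⇒+∣i∣≡i (ℤ.i≤j⇒0≤j-i i≤j))) (sym (j≡i+[j-i] i j))

module Residues (k : ℕ) .{{_ : NonZero k}} where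
  open import Data.Integer using (_≤_; _<_)

  residue : ℤ → Fin k
  residue x = fromℕ< (n%ℕd<d x k)

  division : ∀ x → x ≡ + toℕ (residue x) + (x /ℕ k) * + k
  division x = trans (a≡a%ℕn+[a/ℕn]*n x k)
                     (cong (λ r → + r + (x /ℕ k) * + k) (sym (toℕ-fromℕ< (n%ℕd<d x k))))

  quotient-<⇒< : ∀ {r} r' {q q'} → r ℕ.< k → q < q' → + r + q * + k < + r' + q' * + k
  quotient-<⇒< {r} r' {q} {q'} r<k q<q' = begin-strict
    + r + q * + k    <⟨ ℤ.+-monoˡ-< (q * + k) (+<+ r<k) ⟩
    + k + q * + k    ≡⟨ ℤ.suc-* q (+ k) ⟨
    ℤ.suc q * + k    ≤⟨ ℤ.*-monoʳ-≤-nonNeg (+ k) (ℤ.i<j⇒suc[i]≤j q<q') ⟩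
    q' * + k         ≤⟨ ℤ.i≤j+i (q' * + k) (+ r') ⟩
    + r' + q' * + k  ∎
    where open ℤ.≤-Reasoning

  remainder-unique : ∀ {r r'} q q' → r ℕ.< k → r' ℕ.< k →
                     + r + q * + k ≡ + r' + q' * + k → r ≡ r'
  remainder-unique {r} {r'} q q' r<k r'<k eq with ℤ.<-cmp q q'
  ... | tri< q<q' _ _ = contradiction eq (ℤ.<⇒≢ (quotient-<⇒< r' r<k q<q'))
  ... | tri> _ _ q'<q = contradiction (sym eq) (ℤ.<⇒≢ (quotient-<⇒< r r'<k q'<q))
  ... | tri≈ _ refl _ =
    ℤ.+-injective (trans (sym (e (+ r) (q * + k))) (trans (cong (_- q * + k) eq) (e (+ r') (q * + k))))
    where
    e : ∀ a b → a + b - b ≡ a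
    e = solve-∀

  residue-unique : ∀ {x r} q → r ℕ.< k → x ≡ + r + q * + k → toℕ (residue x) ≡ r
  residue-unique {x} q r<k x≡ =
    remainder-unique (x /ℕ k) q (toℕ<n (residue x)) r<k (trans (sym (division x)) x≡)

  residue-+k : ∀ x → residue (x + + k) ≡ residue x
  residue-+k x = toℕ-injective (residue-unique (x /ℕ k + 1ℤ) (toℕ<n (residue x))
    (trans (cong (_+ + k) (division x)) (e (+ toℕ (residue x)) (x /ℕ k) (+ k))))
    where
    e : ∀ r q K → r + q * K + K ≡ r + (q + 1ℤ) * K
    e = solve-∀

  residue-∸k : ∀ x → residue (x - + k) ≡ residue x
  residue-∸k x = trans (sym (residue-+k (x - + k))) (cong residue (e x (+ k)))
    where
    e : ∀ x K → x - K + K ≡ x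
    e = solve-∀

  residue-toℕ : ∀ i → residue (+ toℕ i) ≡ i
  residue-toℕ i = toℕ-injective (residue-unique 0ℤ (toℕ<n i) (sym (ℤ.+-identityʳ (+ toℕ i))))

  residue-ℕ : ∀ m → residue (+ m) ≡ m mod k
  residue-ℕ m = toℕ-injective (trans (residue-unique (+ (m ℕ./ k)) (m%n<n m k) +m≡)
                                     (sym (toℕ-fromℕ< (m%n<n m k))))
    where
    +m≡ : + m ≡ + (m ℕ.% k) + + (m ℕ./ k) * + k
    +m≡ = begin
      + m                                   ≡⟨ cong +_ (m≡m%n+[m/n]*n m k) ⟩
      + (m ℕ.% k ℕ.+ m ℕ./ k ℕ.* k)         ≡⟨ ℤ.pos-+ (m ℕ.% k) _ ⟩
      + (m ℕ.% k) + + (m ℕ./ k ℕ.* k)       ≡⟨ cong (_+_ (+ (m ℕ.% k))) (ℤ.pos-* (m ℕ./ k) k) ⟩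
      + (m ℕ.% k) + + (m ℕ./ k) * + k       ∎
      where open ≡-Reasoning

  module _ {a} {A : Set a} (f : ℤ → A) (periodic : ∀ z → f (z + + k) ≡ f z) where

    periodic-+ℕ* : ∀ z q → f (z + + q * + k) ≡ f z
    periodic-+ℕ* z zero    = cong f (ℤ.+-identityʳ z)
    periodic-+ℕ* z (suc q) = trans (cong f (e z (+ q) (+ k))) (trans (periodic _) (periodic-+ℕ* z q))
      where
      e : ∀ z q K → z + (1ℤ + q) * K ≡ z + q * K + K
      e = solve-∀

    periodic-+* : ∀ z q → f (z + q * + k) ≡ f z
    periodic-+* z (+ q)    = periodic-+ℕ* z q
    periodic-+* z -[1+ q ] =
      sym (trans (cong f (e z (+ q) (+ k))) (periodic-+ℕ* (z + -[1+ q ] * + k) (suc q)))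
      where
      e : ∀ z q K → z ≡ z + - (1ℤ + q) * K + (1ℤ + q) * K
      e = solve-∀

    periodic-residue : ∀ x → f x ≡ f (+ toℕ (residue x))
    periodic-residue x = trans (cong f (division x)) (periodic-+* (+ toℕ (residue x)) (x /ℕ k))

  prevIdx-residue : ∀ x → prevIdx k (residue (x + 1ℤ)) ≡ residue x
  prevIdx-residue x = begin
    prevIdx k (residue (x + 1ℤ))       ≡⟨ residue-ℕ (r ℕ.+ (k ℕ.∸ 1)) ⟨
    residue (+ (r ℕ.+ (k ℕ.∸ 1)))      ≡⟨ cong residue r+k-1≡ ⟩
    residue (+ r - 1ℤ + + k)           ≡⟨ residue-+k (+ r - 1ℤ) ⟩
    residue (+ r - 1ℤ)                 ≡⟨ periodic-residue (residue ∘ (_- 1ℤ)) shifted-periodic (x + 1ℤ) ⟨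
    residue (x + 1ℤ - 1ℤ)              ≡⟨ cong residue (e₁ x) ⟩
    residue x                          ∎
    where
    open ≡-Reasoning
    r = toℕ (residue (x + 1ℤ))
    e₁ : ∀ x → x + 1ℤ - 1ℤ ≡ x
    e₁ = solve-∀
    e₂ : ∀ r K → r + K ≡ r - 1ℤ + (1ℤ + K)
    e₂ = solve-∀
    e₃ : ∀ z K → z + K - 1ℤ ≡ z - 1ℤ + K
    e₃ = solve-∀
    r+k-1≡ : + (r ℕ.+ (k ℕ.∸ 1)) ≡ + r - 1ℤ + + k
    r+k-1≡ = trans (ℤ.pos-+ r (k ℕ.∸ 1))
               (trans (e₂ (+ r) (+ (k ℕ.∸ 1))) (cong (λ K → + r - 1ℤ + + K) (ℕ.suc-pred k)))
    shifted-periodic : ∀ z → residue (z + + k - 1ℤ) ≡ residue (z - 1ℤ)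
    shifted-periodic z = trans (cong residue (e₃ z (+ k))) (residue-+k (z - 1ℤ))

module Passing (k : ℕ) where

  passed : ∀ {t} → Vec (Turn k) t → ℕ → Fin k → ℕ
  passed as       zero    r = 0
  passed []       (suc s) r = 0
  passed (a ∷ as) (suc s) r = a r ℕ.+ passed as s r

  passed-[] : ∀ s r → passed [] s r ≡ 0
  passed-[] zero    r = refl
  passed-[] (suc s) r = refl

  passed-mono : ∀ {t} (as : Vec (Turn k) t) r {s s'} → s ℕ.≤ s' →
                passed as s r ℕ.≤ passed as s' r
  passed-mono as       r {zero}  _ = ℕ.z≤n
  passed-mono []       r {suc s} _ = ℕ.z≤n
  passed-mono (a ∷ as) r {suc s} {suc s'} (ℕ.s≤s s≤s') =
    ℕ.+-monoʳ-≤ (a r) (passed-mono as r s≤s')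

  passed-cong : ∀ {t} {as bs : Vec (Turn k) t} → Pointwise (λ a b → ∀ i → a i ≡ b i) as bs →
                ∀ s r → passed as s r ≡ passed bs s r
  passed-cong _        zero    r = refl
  passed-cong []       (suc s) r = refl
  passed-cong (a≗b ∷ as≋bs) (suc s) r = cong₂ ℕ._+_ (a≗b r) (passed-cong as≋bs s r)

  passed-injective : ∀ {t} (as bs : Vec (Turn k) t) →
                     (∀ s r → s ℕ.≤ t → passed as s r ≡ passed bs s r) →
                     Pointwise (λ a b → ∀ i → a i ≡ b i) as bs
  passed-injective []       []       _    = []
  passed-injective (a ∷ as) (b ∷ bs) same = a≗b ∷ passed-injective as bs same-tail
    where
    a≗b : ∀ i → a i ≡ b i
    a≗b i = trans (sym (ℕ.+-identityʳ (a i)))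
                  (trans (same 1 i (ℕ.s≤s ℕ.z≤n)) (ℕ.+-identityʳ (b i)))
    same-tail : ∀ s r → s ℕ.≤ _ → passed as s r ≡ passed bs s r
    same-tail s r s≤t = ℕ.+-cancelˡ-≡ (a r) _ _
      (trans (same (suc s) r (ℕ.s≤s s≤t)) (cong (ℕ._+ passed bs s r) (sym (a≗b r))))

  increments : (ℕ → Fin k → ℕ) → (t : ℕ) → Vec (Turn k) t
  increments g zero    = []
  increments g (suc t) = (λ r → g 1 r ℕ.∸ g 0 r) ∷ increments (g ∘ suc) t

  passed-increments : ∀ g → (∀ s r → g s r ℕ.≤ g (suc s) r) →
                      ∀ t {s} r → s ℕ.≤ t → passed (increments g t) s r ℕ.+ g 0 r ≡ g s r
  passed-increments g g-mono t       {zero}  r _ = refl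
  passed-increments g g-mono (suc t) {suc s} r (ℕ.s≤s s≤t) = begin
    (d ℕ.+ p) ℕ.+ g 0 r   ≡⟨ cong (ℕ._+ g 0 r) (ℕ.+-comm d p) ⟩
    (p ℕ.+ d) ℕ.+ g 0 r   ≡⟨ ℕ.+-assoc p d (g 0 r) ⟩
    p ℕ.+ (d ℕ.+ g 0 r)   ≡⟨ cong (p ℕ.+_) (ℕ.m∸n+n≡m (g-mono 0 r)) ⟩
    p ℕ.+ g 1 r           ≡⟨ passed-increments (g ∘ suc) (g-mono ∘ suc) t r s≤t ⟩
    g (suc s) r           ∎
    where
    open ≡-Reasoning
    d = g 1 r ℕ.∸ g 0 r
    p = passed (increments (g ∘ suc) t) s r

module Shapes (k : ℕ) .{{_ : NonZero k}} where
  open import Data.Integer using (_≤_; _<_)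
  open IntegerArithmetic
  open Residues k
  open Passing k

  raise : (ℤ → ℤ) → (Fin k → ℕ) → ℤ → ℤ
  raise β c x = β x + + c (residue x)

  shape : (ℤ → ℤ) → ∀ {t} → Vec (Turn k) t → ℕ → ℤ → ℤ
  shape β as s = raise β (passed as s)

  shape-zero : ∀ β {t} (as : Vec (Turn k) t) x → shape β as 0 x ≡ β x
  shape-zero β as x = ℤ.+-identityʳ (β x)

  shape-[] : ∀ β s x → shape β [] s x ≡ β x
  shape-[] β s x = trans (cong (λ c → β x + + c) (passed-[] s (residue x))) (ℤ.+-identityʳ (β x))

  shape-∷ : ∀ β a {t} (as : Vec (Turn k) t) s x →
            shape β (a ∷ as) (suc s) x ≡ shape (raise β a) as s x
  shape-∷ β a as s x =
    trans (cong (_+_ (β x)) (ℤ.pos-+ (a r) (passed as s r))) (sym (ℤ.+-assoc (β x) (+ a r) _))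
    where
    r = residue x

  shape-∷-one : ∀ β a {t} (as : Vec (Turn k) t) x → shape β (a ∷ as) 1 x ≡ raise β a x
  shape-∷-one β a as x = trans (shape-∷ β a as 0 x) (shape-zero (raise β a) as x)

  shape-mono : ∀ β {t} (as : Vec (Turn k) t) x {s s'} → s ℕ.≤ s' →
               shape β as s x ≤ shape β as s' x
  shape-mono β as x s≤s' = ℤ.+-monoʳ-≤ (β x) (+≤+ (passed-mono as (residue x) s≤s'))

  HasArrangement : (ℤ → ℤ) → Arrangement k → Set
  HasArrangement β m = ∀ x → β x ≡ β (x + 1ℤ) + + m (residue (x + 1ℤ))

  arrangement⇒decreasing : ∀ {β m} → HasArrangement β m → ∀ x → β (x + 1ℤ) ≤ β x
  arrangement⇒decreasing {β} arr x = subst (β (x + 1ℤ) ≤_) (sym (arr x)) (ℤ.i≤i+j _ _)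

  raise-applyTurn : ∀ {β m a} → HasArrangement β m → (∀ i → a i ℕ.≤ m i) →
                    HasArrangement (raise β a) (applyTurn m a)
  raise-applyTurn {β} {m} {a} arr a≤m x = begin
    β x + + a r                         ≡⟨ cong (_+ + a r) (arr x) ⟩
    β′ + + m p + + a r                  ≡⟨ ℤ.+-assoc β′ (+ m p) (+ a r) ⟩
    β′ + + (m p ℕ.+ a r)                ≡⟨ cong (λ c → β′ + + c) held ⟩
    β′ + + (a p ℕ.+ applyTurn m a p)    ≡⟨ ℤ.+-assoc β′ (+ a p) (+ applyTurn m a p) ⟨
    β′ + + a p + + applyTurn m a p      ∎
    where
    open ≡-Reasoning
    β′ = β (x + 1ℤ)
    r = residue x
    p = residue (x + 1ℤ)
    held : m p ℕ.+ a r ≡ a p ℕ.+ applyTurn m a p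
    held = begin
      m p ℕ.+ a r                       ≡⟨ cong (ℕ._+ a r) (ℕ.m+[n∸m]≡n (a≤m p)) ⟨
      a p ℕ.+ (m p ℕ.∸ a p) ℕ.+ a r     ≡⟨ ℕ.+-assoc (a p) (m p ℕ.∸ a p) (a r) ⟩
      a p ℕ.+ (m p ℕ.∸ a p ℕ.+ a r)     ≡⟨ cong (λ i → a p ℕ.+ (m p ℕ.∸ a p ℕ.+ a i))
                                                 (prevIdx-residue x) ⟨
      a p ℕ.+ applyTurn m a p           ∎

  turn⇒interlaced : ∀ {β m a} → HasArrangement β m → (∀ i → a i ℕ.≤ m i) →
                    ∀ x → raise β a (x + 1ℤ) ≤ β x
  turn⇒interlaced {β} {m} {a} arr a≤m x =
    subst (raise β a (x + 1ℤ) ≤_) (sym (arr x))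
          (ℤ.+-monoʳ-≤ (β (x + 1ℤ)) (+≤+ (a≤m (residue (x + 1ℤ)))))

  interlaced⇒turn : ∀ {β m a} → HasArrangement β m → (∀ x → raise β a (x + 1ℤ) ≤ β x) →
                    ∀ i → a i ℕ.≤ m i
  interlaced⇒turn {β} {m} {a} arr fits i = subst (λ j → a j ℕ.≤ m j) residue≡i
    (ℤ.drop‿+≤+ (+-cancelˡ-≤ (β (x + 1ℤ)) (subst (raise β a (x + 1ℤ) ≤_) (arr x) (fits x))))
    where
    x = + toℕ i - 1ℤ
    e : ∀ u → u - 1ℤ + 1ℤ ≡ u
    e = solve-∀
    residue≡i : residue (x + 1ℤ) ≡ i
    residue≡i = trans (cong residue (e (+ toℕ i))) (residue-toℕ i)

  Interlaced : (ℤ → ℤ) → ∀ {t} → Vec (Turn k) t → Set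
  Interlaced β {t} as = ∀ s x → s ℕ.< t → shape β as (suc s) (x + 1ℤ) ≤ shape β as s x

  legal⇒interlaced : ∀ {β m t} (as : Vec (Turn k) t) → HasArrangement β m → Legal m as →
                     Interlaced β as
  legal⇒interlaced {β} (a ∷ as) arr (a≤m , _) zero x _ =
    subst₂ _≤_ (sym (shape-∷-one β a as (x + 1ℤ))) (sym (shape-zero β (a ∷ as) x))
               (turn⇒interlaced arr a≤m x)
  legal⇒interlaced {β} (a ∷ as) arr (a≤m , legal) (suc s) x (ℕ.s≤s s<t) =
    subst₂ _≤_ (sym (shape-∷ β a as (suc s) (x + 1ℤ))) (sym (shape-∷ β a as s x))
      (legal⇒interlaced as (raise-applyTurn arr a≤m) legal s x s<t)

  interlaced⇒legal : ∀ {β m t} (as : Vec (Turn k) t) → HasArrangement β m → Interlaced β as →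
                     Legal m as
  interlaced⇒legal []       _   _     = tt
  interlaced⇒legal {β} (a ∷ as) arr inter =
    a≤m , interlaced⇒legal as (raise-applyTurn arr a≤m) inter-tail
    where
    a≤m : ∀ i → a i ℕ.≤ _
    a≤m = interlaced⇒turn arr λ x →
      subst₂ _≤_ (shape-∷-one β a as (x + 1ℤ)) (shape-zero β (a ∷ as) x)
                 (inter 0 x (ℕ.s≤s ℕ.z≤n))
    inter-tail : Interlaced (raise β a) as
    inter-tail s x s<t =
      subst₂ _≤_ (shape-∷ β a as (suc s) (x + 1ℤ)) (shape-∷ β a as s x)
                 (inter (suc s) x (ℕ.s≤s s<t))

  legal⇒decreasing : ∀ {β m t} (as : Vec (Turn k) t) → HasArrangement β m → Legal m as →
                     ∀ s x → shape β as s (x + 1ℤ) ≤ shape β as s x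
  legal⇒decreasing {β} {m} [] arr _ s x =
    subst₂ _≤_ (sym (shape-[] β s (x + 1ℤ))) (sym (shape-[] β s x))
               (arrangement⇒decreasing {β} {m} arr x)
  legal⇒decreasing {β} {m} (a ∷ as) arr _ zero x =
    subst₂ _≤_ (sym (shape-zero β (a ∷ as) (x + 1ℤ))) (sym (shape-zero β (a ∷ as) x))
               (arrangement⇒decreasing {β} {m} arr x)
  legal⇒decreasing {β} (a ∷ as) arr (a≤m , legal) (suc s) x =
    subst₂ _≤_ (sym (shape-∷ β a as s (x + 1ℤ))) (sym (shape-∷ β a as s x))
      (legal⇒decreasing as (raise-applyTurn arr a≤m) legal s x)

module Cylindric (k n : ℕ) .{{_ : NonZero k}} where
  open import Data.Integer using (_≤_)
  open IntegerArithmetic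
  open Residues k
  open Shapes k

  n-k : ℤ
  n-k = + n - + k

  period⁻ : ∀ (α : CylPart k n) x → part α (x - + k) ≡ part α x + n-k
  period⁻ α x = trans (period α (x - + k)) (cong (λ z → part α z + n-k) (e x (+ k)))
    where
    e : ∀ x K → x - K + K ≡ x
    e = solve-∀

  decr-suc : ∀ (α : CylPart k n) x → part α (x + 1ℤ) ≤ part α x
  decr-suc α x = decr α x (x + 1ℤ) (ℤ.i≤i+j x 1ℤ)

  gap : CylPart k n → ℤ → ℤ
  gap α z = part α (z - 1ℤ) - part α z

  gap-nonneg : ∀ α z → 0ℤ ≤ gap α z
  gap-nonneg α z = ℤ.i≤j⇒0≤j-i (decr α (z - 1ℤ) z (ℤ.i-j≤i z 1ℤ))

  gap-periodic : ∀ α z → gap α (z + + k) ≡ gap α z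
  gap-periodic α z = begin
    part α (z + + k - 1ℤ) - b   ≡⟨ cong (λ w → part α w - b) (e z (+ k)) ⟩
    a - b                       ≡⟨ i-j≡[i+l]-[j+l] a b n-k ⟩
    (a + n-k) - (b + n-k)       ≡⟨ cong₂ _-_ (period α (z - 1ℤ)) (period α z) ⟨
    gap α z                     ∎
    where
    open ≡-Reasoning
    a = part α (z - 1ℤ + + k)
    b = part α (z + + k)
    e : ∀ z K → z + K - 1ℤ ≡ z - 1ℤ + K
    e = solve-∀

  Arr-arrangement : ∀ α → HasArrangement (part α) (Arr α)
  Arr-arrangement α x = begin
    part α x               ≡⟨ j≡i+[j-i] α′ (part α x) ⟩
    α′ + (part α x - α′)   ≡⟨ cong (λ z → α′ + (part α z - α′)) (e x) ⟨
    α′ + gap α (x + 1ℤ)    ≡⟨ cong (_+_ α′) (periodic-residue (gap α) (gap-periodic α) (x + 1ℤ)) ⟩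
    α′ + gap α (+ toℕ r)   ≡⟨ cong (_+_ α′) (ℤ.0≤i⇒+∣i∣≡i (gap-nonneg α (+ toℕ r))) ⟨
    α′ + + Arr α r         ∎
    where
    open ≡-Reasoning
    α′ = part α (x + 1ℤ)
    r = residue (x + 1ℤ)
    e : ∀ x → x + 1ℤ - 1ℤ ≡ x
    e = solve-∀

module Correspondence (k n : ℕ) .{{_ : NonZero k}} (μ : CylPart k n) where
  open import Data.Integer using (_≤_; _<_; _≤?_; _<?_)
  open Counting
  open IntegerArithmetic
  open Residues k
  open Passing k
  open Shapes k
  open Cylindric k n

  module FromGame {t} (g : MarbleGame k t (Arr μ)) where

    α : ℕ → ℤ → ℤ
    α = shape (part μ) (turns g)

    α-interlaced : Interlaced (part μ) (turns g)
    α-interlaced = legal⇒interlaced (turns g) (Arr-arrangement μ) (legal g)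

    α-antitone : ∀ s {x x'} → x ≤ x' → α s x' ≤ α s x
    α-antitone s = antitone-by-steps (α s) (legal⇒decreasing (turns g) (Arr-arrangement μ) (legal g) s)

    α-period⁻ : ∀ s x → α s (x - + k) ≡ α s x + n-k
    α-period⁻ s x =
      trans (cong₂ (λ u r → u + + passed (turns g) s r) (period⁻ μ x) (residue-∸k x)) (e (part μ x) n-k _)
      where
      e : ∀ a b c → a + b + c ≡ a + c + b
      e = solve-∀

    α-period : ∀ s x → α s x ≡ α s (x + + k) + n-k
    α-period s x = trans (cong (α s) (e x (+ k))) (α-period⁻ s (x + + k))
      where
      e : ∀ x K → x ≡ x + K - K
      e = solve-∀

    outerShape : CylPart k n
    outerShape = record { part = α t ; decr = λ _ _ → α-antitone t ; period = α-period t }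

    -- A box gets s + 1 when it is added in turn s, i.e. it counts the shapes not yet containing it.
    entryAt : ℤ → ℤ → ℕ
    entryAt x y = count (λ s → α s x <? y) t

    outside-downClosed : ∀ x y → DownClosed (λ s → α s x < y) t
    outside-downClosed x y i≤j _ αⱼ<y = ℤ.≤-<-trans (shape-mono (part μ) (turns g) x i≤j) αⱼ<y

    outside-initial : ∀ {x y} → part μ x < y → α 0 x < y
    outside-initial {x} = subst (_< _) (sym (shape-zero (part μ) (turns g) x))

    entry-period : ∀ x y → entryAt x y ≡ entryAt (x - + k) (y + n-k)
    entry-period x y = count-cong _ _ t
      (λ {s} _ αₛ<y → subst (_< y + n-k) (sym (α-period⁻ s x)) (ℤ.+-monoˡ-< n-k αₛ<y))
      (λ {s} _ α-ₛ<y → +-cancelʳ-< n-k (subst (_< y + n-k) (α-period⁻ s x) α-ₛ<y))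

    game-nonempty : ∀ {x y} → InSkew μ outerShape x y → 0 ℕ.< t
    game-nonempty {x} {y} (μ<y , y≤α) = ℕ.n≢0⇒n>0 λ t≡0 →
      ℤ.<-irrefl refl (ℤ.<-≤-trans (outside-initial μ<y) (subst (λ s → y ≤ α s x) t≡0 y≤α))

    entry-range : ∀ {x y} → InSkew μ outerShape x y → 1 ℕ.≤ entryAt x y × entryAt x y ℕ.≤ t
    entry-range {x} {y} box@(μ<y , _) =
      holds⇒<count _ (outside-downClosed x y) (game-nonempty box) (outside-initial μ<y) , count-≤ _ t

    -- Interlacing gives α (s + 1) x' ≤ α s x for x < x', so every turn at which (x, y) is still
    -- outside is followed by one at which (x', y) is still outside.
    entry-column-strict : ∀ {x x' y} → x < x' →
                          InSkew μ outerShape x y → InSkew μ outerShape x' y →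
                          entryAt x y ℕ.< entryAt x' y
    entry-column-strict {x} {x'} {y} x<x' _ (μ<y , y≤α) =
      holds⇒<count _ (outside-downClosed x' y) e<t (outside-upto ℕ.≤-refl)
      where
      e = entryAt x y
      outside-upto : ∀ {j} → j ℕ.≤ e → α j x' < y
      outside-upto {zero}  _   = outside-initial μ<y
      outside-upto {suc j} j<e = ℤ.≤-<-trans
        (ℤ.≤-trans (α-antitone (suc j) (i<j⇒i+1≤j x<x'))
                   (α-interlaced j x (ℕ.<-≤-trans j<e (count-≤ _ t))))
        (<count⇒holds _ (outside-downClosed x y) j<e)
      e<t : e ℕ.< t
      e<t = ℕ.≤∧≢⇒< (count-≤ _ t) λ e≡t →
        ℤ.<-irrefl refl
          (ℤ.<-≤-trans (subst (λ s → α s x' < y) e≡t (outside-upto ℕ.≤-refl)) y≤α)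

    tableau : Tableau k n t μ
    tableau = record
      { outer   = outerShape
      ; inner⊆  = λ x → ℤ.i≤i+j (part μ x) _
      ; entry   = entryAt
      ; cyl     = λ x y _ → entry-period x y
      ; range   = λ _ _ → entry-range
      ; rowWeak = λ x y y' y≤y' _ _ → count-mono _ _ t (λ _ αₛ<y → ℤ.<-≤-trans αₛ<y y≤y')
      ; colStr  = λ _ _ _ → entry-column-strict
      }

  toTableau : ∀ {t} → MarbleGame k t (Arr μ) → Tableau k n t μ
  toTableau = FromGame.tableau

  module Rows {t} (T : Tableau k n t μ) where

    rowLength : ℤ → ℕ
    rowLength x = ∣ part (outer T) x - part μ x ∣

    outer≡μ+rowLength : ∀ x → part (outer T) x ≡ part μ x + + rowLength x
    outer≡μ+rowLength x = trans (j≡i+[j-i] (part μ x) (part (outer T) x))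
      (cong (_+_ (part μ x)) (sym (ℤ.0≤i⇒+∣i∣≡i (ℤ.i≤j⇒0≤j-i (inner⊆ T x)))))

    rowEntry : ℤ → ℕ → ℕ
    rowEntry x j = entry T x (part μ x + + suc j)

    rowEntry-box : ∀ {x j} → j ℕ.< rowLength x → InSkew μ (outer T) x (part μ x + + suc j)
    rowEntry-box {x} j<len =
      i<i+1+n (part μ x) _ ,
      subst (_ ≤_) (sym (outer≡μ+rowLength x)) (ℤ.+-monoʳ-≤ (part μ x) (+≤+ j<len))

    box-rowEntry : ∀ {x y} → InSkew μ (outer T) x y →
                   ∃ λ j → y ≡ part μ x + + suc j × j ℕ.< rowLength x
    box-rowEntry {x} {y} (μ<y , y≤λ) with <⇒≡+suc μ<y
    ... | j , y≡ =
      j , y≡ , ℤ.drop‿+≤+ (+-cancelˡ-≤ (part μ x) (subst₂ _≤_ y≡ (outer≡μ+rowLength x) y≤λ))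

    rowCount : ℤ → ℕ → ℕ
    rowCount x s = count (λ j → rowEntry x j ℕ.≤? s) (rowLength x)

    rowEntry-range : ∀ {x j} → j ℕ.< rowLength x → 1 ℕ.≤ rowEntry x j × rowEntry x j ℕ.≤ t
    rowEntry-range j<len = range T _ _ (rowEntry-box j<len)

    rowEntry-downClosed : ∀ x s → DownClosed (λ j → rowEntry x j ℕ.≤ s) (rowLength x)
    rowEntry-downClosed x s i≤j j<len eⱼ≤s = ℕ.≤-trans
      (rowWeak T x _ _ (ℤ.+-monoʳ-≤ (part μ x) (+≤+ (ℕ.s≤s i≤j)))
               (rowEntry-box (ℕ.≤-<-trans i≤j j<len)) (rowEntry-box j<len))
      eⱼ≤s

    ≤⇒<rowCount : ∀ {x s j} → j ℕ.< rowLength x → rowEntry x j ℕ.≤ s → j ℕ.< rowCount x s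
    ≤⇒<rowCount {x} {s} = holds⇒<count _ (rowEntry-downClosed x s)

    <rowCount⇒≤ : ∀ {x s j} → j ℕ.< rowCount x s → rowEntry x j ℕ.≤ s
    <rowCount⇒≤ {x} {s} = <count⇒holds _ (rowEntry-downClosed x s)

    rowCount-zero : ∀ x → rowCount x 0 ≡ 0
    rowCount-zero x = count-none-from _ 0 (rowLength x) ℕ.z≤n
      (λ _ j<len eⱼ≤0 → ℕ.<⇒≱ (proj₁ (rowEntry-range j<len)) eⱼ≤0)

    rowCount-full : ∀ x → rowCount x t ≡ rowLength x
    rowCount-full x = count-all _ (rowLength x) (proj₂ ∘ rowEntry-range)

    rowCount-mono : ∀ x s → rowCount x s ℕ.≤ rowCount x (suc s)
    rowCount-mono x s = count-mono _ _ (rowLength x) (λ _ → ℕ.m≤n⇒m≤1+n)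

    rowLength-periodic : ∀ x → rowLength (x + + k) ≡ rowLength x
    rowLength-periodic x = cong ∣_∣ (trans
      (i-j≡[i+l]-[j+l] (part (outer T) (x + + k)) (part μ (x + + k)) n-k)
      (sym (cong₂ _-_ (period (outer T) x) (period μ x))))

    rowEntry-periodic : ∀ {x j} → j ℕ.< rowLength x → rowEntry (x + + k) j ≡ rowEntry x j
    rowEntry-periodic {x} {j} j<len = trans
      (cyl T (x + + k) _ (rowEntry-box (subst (j ℕ.<_) (sym (rowLength-periodic x)) j<len)))
      (cong₂ (entry T) (e₁ x (+ k)) (trans (e₂ (part μ (x + + k)) (+ suc j) n-k)
                                           (cong (_+ + suc j) (sym (period μ x)))))
      where
      e₁ : ∀ x K → x + K - K ≡ x
      e₁ = solve-∀
      e₂ : ∀ a b c → a + b + c ≡ a + c + b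
      e₂ = solve-∀

    rowCount-periodic : ∀ s x → rowCount (x + + k) s ≡ rowCount x s
    rowCount-periodic s x =
      trans (cong (count (λ j → rowEntry (x + + k) j ℕ.≤? s)) (rowLength-periodic x))
      (count-cong _ _ (rowLength x) (λ j<len → subst (ℕ._≤ s) (rowEntry-periodic j<len))
                                    (λ j<len → subst (ℕ._≤ s) (sym (rowEntry-periodic j<len))))

    rowCount-residue : ∀ x s → rowCount x s ≡ rowCount (+ toℕ (residue x)) s
    rowCount-residue x s = periodic-residue (λ z → rowCount z s) (rowCount-periodic s) x

  rowCount-cong : ∀ {t} {T U : Tableau k n t μ} → T ≈T U →
                  ∀ x s → Rows.rowCount T x s ≡ Rows.rowCount U x s
  rowCount-cong {T = T} {U} (same-outer , same-entry) x s =
    trans (cong (count (λ j → T.rowEntry x j ℕ.≤? s)) same-length)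
          (count-cong _ _ (U.rowLength x) (λ j<len → subst (ℕ._≤ s) (same-rowEntry j<len))
                                          (λ j<len → subst (ℕ._≤ s) (sym (same-rowEntry j<len))))
    where
    module T = Rows T
    module U = Rows U
    same-length : T.rowLength x ≡ U.rowLength x
    same-length = cong (λ z → ∣ z - part μ x ∣) (same-outer x)
    same-rowEntry : ∀ {j} → j ℕ.< U.rowLength x → T.rowEntry x j ≡ U.rowEntry x j
    same-rowEntry j<len = same-entry x _ (T.rowEntry-box (subst (_ ℕ.<_) (sym same-length) j<len))

  module FromTableau {t} (T : Tableau k n t μ) where
    open Rows T

    rowCounts : ℕ → Fin k → ℕ
    rowCounts s r = rowCount (+ toℕ r) s

    rowCounts-mono : ∀ s r → rowCounts s r ℕ.≤ rowCounts (suc s) r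
    rowCounts-mono s r = rowCount-mono (+ toℕ r) s

    turnsOf : Vec (Turn k) t
    turnsOf = increments rowCounts t

    shape-turnsOf : ∀ {s} x → s ℕ.≤ t → shape (part μ) turnsOf s x ≡ part μ x + + rowCount x s
    shape-turnsOf {s} x s≤t = cong (λ c → part μ x + + c) (begin
      passed turnsOf s r                     ≡⟨ ℕ.+-identityʳ _ ⟨
      passed turnsOf s r ℕ.+ 0               ≡⟨ cong (passed turnsOf s r ℕ.+_) (rowCount-zero (+ toℕ r)) ⟨
      passed turnsOf s r ℕ.+ rowCounts 0 r   ≡⟨ passed-increments rowCounts rowCounts-mono t r s≤t ⟩
      rowCounts s r                          ≡⟨ rowCount-residue x s ⟨
      rowCount x s                           ∎)
      where
      open ≡-Reasoning
      r = residue x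

    -- The box above one with entry ≤ s + 1 lies in μ or, by column strictness, has entry ≤ s.
    box-below-fits : ∀ {x s j} → j ℕ.< rowCount (x + 1ℤ) (suc s) →
                     part μ (x + 1ℤ) + + suc j ≤ part μ x + + rowCount x s
    box-below-fits {x} {s} {j} j<count with part μ (x + 1ℤ) + + suc j ≤? part μ x
    ... | yes y≤μ = ℤ.≤-trans y≤μ (ℤ.i≤i+j _ _)
    ... | no  y≰μ = subst (_≤ _) (sym y≡) (ℤ.+-monoʳ-≤ (part μ x) (+≤+ j'<count))
      where
      y = part μ (x + 1ℤ) + + suc j
      j<len : j ℕ.< rowLength (x + 1ℤ)
      j<len = ℕ.<-≤-trans j<count (count-≤ _ _)
      box-below : InSkew μ (outer T) (x + 1ℤ) y
      box-below = rowEntry-box j<len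
      box : InSkew μ (outer T) x y
      box = ℤ.≰⇒> y≰μ , ℤ.≤-trans (proj₂ box-below) (decr-suc (outer T) x)
      j' = proj₁ (box-rowEntry box)
      y≡ : y ≡ part μ x + + suc j'
      y≡ = proj₁ (proj₂ (box-rowEntry box))
      entry≤s : rowEntry x j' ℕ.≤ s
      entry≤s = ℕ.s≤s⁻¹ (ℕ.≤-trans
        (subst (λ w → entry T x w ℕ.< entry T (x + 1ℤ) y) y≡
               (colStr T x (x + 1ℤ) y (i<i+1+n x 0) box box-below))
        (<rowCount⇒≤ j<count))
      j'<count : j' ℕ.< rowCount x s
      j'<count = ≤⇒<rowCount (proj₂ (proj₂ (box-rowEntry box))) entry≤s

    rowCounts-interlaced : ∀ x s →
                           part μ (x + 1ℤ) + + rowCount (x + 1ℤ) (suc s) ≤ part μ x + + rowCount x s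
    rowCounts-interlaced x s with rowCount (x + 1ℤ) (suc s) in count≡
    ... | zero  = ℤ.≤-trans (subst (_≤ part μ x) (sym (ℤ.+-identityʳ _)) (decr-suc μ x)) (ℤ.i≤i+j _ _)
    ... | suc j = box-below-fits (subst (j ℕ.<_) (sym count≡) ℕ.≤-refl)

    turnsOf-legal : Legal (Arr μ) turnsOf
    turnsOf-legal = interlaced⇒legal turnsOf (Arr-arrangement μ) λ s x s<t →
      subst₂ _≤_ (sym (shape-turnsOf (x + 1ℤ) s<t)) (sym (shape-turnsOf x (ℕ.<⇒≤ s<t)))
                 (rowCounts-interlaced x s)

    game : MarbleGame k t (Arr μ)
    game = record { turns = turnsOf ; legal = turnsOf-legal }

    toTableau-game : toTableau game ≈T T
    toTableau-game = same-outer , same-entry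
      where
      same-outer : ∀ x → part (outer (toTableau game)) x ≡ part (outer T) x
      same-outer x = trans (shape-turnsOf x ℕ.≤-refl)
        (trans (cong (λ c → part μ x + + c) (rowCount-full x)) (sym (outer≡μ+rowLength x)))
      same-entry : ∀ x y → InSkew μ (outer (toTableau game)) x y →
                   entry (toTableau game) x y ≡ entry T x y
      same-entry x y (μ<y , y≤α) with box-rowEntry (μ<y , subst (y ≤_) (same-outer x) y≤α)
      ... | j , refl , j<len =
        count-exact _ (proj₂ (rowEntry-range j<len)) outside⇒before before⇒outside
        where
        outside⇒before : ∀ {s} → s ℕ.< t → shape (part μ) turnsOf s x < part μ x + + suc j →
                         s ℕ.< rowEntry x j
        outside⇒before {s} s<t outside = ℕ.≰⇒> λ entry≤s → ℕ.<⇒≱ (≤⇒<rowCount j<len entry≤s)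
          (i+m<i+1+n⇒m≤n (part μ x) (subst (_< _) (shape-turnsOf x (ℕ.<⇒≤ s<t)) outside))
        before⇒outside : ∀ {s} → s ℕ.< rowEntry x j → shape (part μ) turnsOf s x < part μ x + + suc j
        before⇒outside {s} s<entry = subst (_< _) (sym (shape-turnsOf x s≤t))
          (m≤n⇒i+m<i+1+n (part μ x) (ℕ.≮⇒≥ λ j<count → ℕ.<⇒≱ s<entry (<rowCount⇒≤ j<count)))
          where
          s≤t = ℕ.<⇒≤ (ℕ.<-≤-trans s<entry (proj₂ (rowEntry-range j<len)))

  module _ {t} (g : MarbleGame k t (Arr μ)) (x : ℤ) where
    open Rows (toTableau g)
    open FromGame g

    rowLength-toTableau : rowLength x ≡ passed (turns g) t (residue x)
    rowLength-toTableau = cong ∣_∣ (e (part μ x) (+ passed (turns g) t (residue x)))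
      where
      e : ∀ a b → a + b - a ≡ b
      e = solve-∀

    rowCount-toTableau : ∀ {s} → s ℕ.≤ t → rowCount x s ≡ passed (turns g) s (residue x)
    rowCount-toTableau {s} s≤t with ℕ.m≤n⇒m<n∨m≡n s≤t
    ... | inj₂ refl = trans (rowCount-full x) rowLength-toTableau
    ... | inj₁ s<t  = trans (cong (count (λ j → rowEntry x j ℕ.≤? s)) rowLength-toTableau)
      (count-exact _ (passed-mono (turns g) (residue x) s≤t) entry≤⇒< <⇒entry≤)
      where
      entry≤⇒< : ∀ {j} → j ℕ.< passed (turns g) t (residue x) → rowEntry x j ℕ.≤ s →
                 j ℕ.< passed (turns g) s (residue x)
      entry≤⇒< _ entry≤s = ℕ.≰⇒> λ passed≤j → ℕ.<⇒≱
        (holds⇒<count _ (outside-downClosed x _) s<t (m≤n⇒i+m<i+1+n (part μ x) passed≤j)) entry≤s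
      <⇒entry≤ : ∀ {j} → j ℕ.< passed (turns g) s (residue x) → rowEntry x j ℕ.≤ s
      <⇒entry≤ j<passed = ℕ.≮⇒≥ λ s<entry → ℕ.<⇒≱ j<passed
        (i+m<i+1+n⇒m≤n (part μ x) (<count⇒holds _ (outside-downClosed x _) s<entry))

  toTableau-cong : ∀ {t} {g h : MarbleGame k t (Arr μ)} → g ≈G h → toTableau g ≈T toTableau h
  toTableau-cong {t} {g} {h} g≋h = same-α t , λ x y _ →
    count-cong _ _ t (λ {s} _ → subst (_< y) (same-α s x)) (λ {s} _ → subst (_< y) (sym (same-α s x)))
    where
    same-α : ∀ s x → FromGame.α g s x ≡ FromGame.α h s x
    same-α s x = cong (λ c → part μ x + + c) (passed-cong g≋h s (residue x))

  toTableau-injective : ∀ {t} {g h : MarbleGame k t (Arr μ)} → toTableau g ≈T toTableau h → g ≈G h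
  toTableau-injective {g = g} {h} same = passed-injective (turns g) (turns h) λ s r s≤t → begin
    passed (turns g) s r                          ≡⟨ cong (passed (turns g) s) (residue-toℕ r) ⟨
    passed (turns g) s (residue (+ toℕ r))        ≡⟨ rowCount-toTableau g (+ toℕ r) s≤t ⟨
    Rows.rowCount (toTableau g) (+ toℕ r) s       ≡⟨ rowCount-cong {T = toTableau g} {toTableau h} same _ s ⟩
    Rows.rowCount (toTableau h) (+ toℕ r) s       ≡⟨ rowCount-toTableau h (+ toℕ r) s≤t ⟩
    passed (turns h) s (residue (+ toℕ r))        ≡⟨ cong (passed (turns h) s) (residue-toℕ r) ⟩
    passed (turns h) s r                          ∎
    where open ≡-Reasoning

  bijection : ∀ t → Bijection (GameSetoid k t (Arr μ)) (TableauSetoid k n t μ)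
  bijection t = record
    { to        = toTableau
    ; cong      = λ {g} {h} → toTableau-cong {g = g} {h}
    ; bijective = (λ {g} {h} → toTableau-injective {g = g} {h}) ,
                  λ T → FromTableau.game T , λ {g} g≈game →
        Setoid.trans (TableauSetoid k n t μ) {toTableau g} {toTableau (FromTableau.game T)} {T}
          (toTableau-cong {g = g} {FromTableau.game T} g≈game) (FromTableau.toTableau-game T)
    }

open import Data.Nat using (_<_)

mainTheorem5 : (k n : ℕ) .{{_ : NonZero k}} → k < n → (μ : CylPart k n) → (t : ℕ) →
    Bijection (GameSetoid k t (Arr μ)) (TableauSetoid k n t μ)
mainTheorem5 k n _ μ t = Correspondence.bijection k n μ t
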